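{- Let $k>1$ be an integer. If there exists $\alpha\ge2$ such that $N_\alpha(k,k)<N_{\alpha+1}(k,k)$, then at least one of the following holds: (1) Letting $W_{k,\alpha}$ be the set of words over $[\alpha+1]=\{1,\dots,\alpha+1\}$ of length $N_\alpha(k,k)$ that have no factor which is a $k$-power or a $k$-anti-power, for every $w\in W_{k,\alpha}$ the two factors of $w$ of length $N_\alpha(k,k)-1$ (its prefix and its suffix of that length) each use exactly $\alpha+1$ distinct letters. (2) There exists a word $w$ over $[\alpha]$ having no factor which is a $k$-power or a $k$-anti-power, of the form $$w=u_1(1u_1)^{k-1}x_1=u_2(2u_2)^{k-1}x_2=\cdots=u_\alpha(\alpha u_\alpha)^{k-1}x_\alpha,$$ where $x_1,\dots,x_\alpha,u_1,\dots,u_\alpha$ are finite words, $|u_1|<\cdots<|u_\alpha|$, and for all $1\le i<j\le\alpha$, $$\gcd(|u_i|+1,|u_j|+1)\le \frac{|u_j|+1}{k-1}.$$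
   Context: A factor of a word is a contiguous subword. A $k$-power is a word $u^k$ ($k$ copies of a nonempty word $u$). A $k$-anti-power is a word $w_1\cdots w_k$ with $|w_1|=\cdots=|w_k|$ and $w_1,\dots,w_k$ pairwise distinct. $N_\alpha(k,k)$ is the smallest positive integer such that every word of length $N_\alpha(k,k)$ over an alphabet of size $\alpha$ has a factor that is a $k$-power or a $k$-anti-power. In (2), $a u$ for a letter $a\in[\alpha]$ denotes the word obtained by prepending $a$ to $u$. -}

module Defs where

open import Data.Nat using (ℕ; zero; suc; _+_; _*_; _∸_; _≤_; _<_)
open import Data.Nat.GCD using (gcd)
open import Data.Fin as Fin using (Fin)
open import Data.List using (List; []; _∷_; _++_; length; concat; replicate; take; drop; deduplicate)
open import Data.List.Relation.Unary.All using (All)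
open import Data.List.Relation.Unary.Unique.Propositional using (Unique)
open import Data.Product using (Σ; ∃; ∃-syntax; _×_; _,_)
open import Data.Sum using (_⊎_)
open import Relation.Nullary using (¬_)
open import Relation.Binary.PropositionalEquality using (_≡_; _≢_)

-- Words over the alphabet [α] = {1,…,α}, letter i represented by Fin α element i-1.
Word : ℕ → Set
Word α = List (Fin α)

module _ {A : Set} where
  Factor : List A → List A → Set
  Factor f w = ∃[ p ] ∃[ s ] (p ++ f ++ s ≡ w)

  IsPower : ℕ → List A → Set
  IsPower k w = ∃[ u ] (u ≢ [] × w ≡ concat (replicate k u))

  IsAntiPower : ℕ → List A → Set
  IsAntiPower k w = ∃[ ws ] ∃[ m ]
    (length ws ≡ k × All (λ b → length b ≡ m) ws × Unique ws × w ≡ concat ws)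

  Avoids : ℕ → List A → Set
  Avoids k w = ∀ f → Factor f w → ¬ (IsPower k f ⊎ IsAntiPower k f)

Unavoidable : ℕ → ℕ → ℕ → Set
Unavoidable α k n = (w : Word α) → length w ≡ n →
  ∃[ f ] (Factor f w × (IsPower k f ⊎ IsAntiPower k f))

IsN : ℕ → ℕ → ℕ → Set
IsN α k n = 0 < n × Unavoidable α k n × (∀ m → 0 < m → Unavoidable α k m → n ≤ m)

distinctLetters : ∀ {α} → Word α → ℕ
distinctLetters = length ∘′ deduplicate Fin._≟_
  where open import Function using (_∘′_)

Alt1 : ℕ → ℕ → ℕ → Set
Alt1 k α N = (w : Word (suc α)) → length w ≡ N → Avoids k w →
  distinctLetters (take (N ∸ 1) w) ≡ suc α × distinctLetters (drop 1 w) ≡ suc α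

-- Alternative (2); the inequality gcd(|uᵢ|+1,|uⱼ|+1) ≤ (|uⱼ|+1)/(k-1)
-- is written with the (positive, since k>1) denominator cleared.
Alt2 : ℕ → ℕ → Set
Alt2 k α = Σ (Word α) λ w → (Avoids k w ×
  Σ (Fin α → Word α) λ u → Σ (Fin α → Word α) λ x →
  ( (∀ (i : Fin α) → w ≡ u i ++ concat (replicate (k ∸ 1) (i ∷ u i)) ++ x i)
  × (∀ (i j : Fin α) → i Fin.< j → length (u i) < length (u j))
  × (∀ (i j : Fin α) → i Fin.< j →
       gcd (suc (length (u i))) (suc (length (u j))) * (k ∸ 1) ≤ suc (length (u j)))))

-- Let N = N_α(k,k) and suppose (1) fails: since (1) is a decidable property of finitely
-- many words, there is a word w of length N over α+1 letters avoiding k-powers and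
-- k-anti-powers whose suffix (or, after reversing w, prefix) of length N−1 uses at most
-- α letters. Write w = c p and relabel p injectively into α letters as p′. The letter c
-- does not occur in p, for otherwise all of w could be relabelled into α letters. Hence
-- for every letter j the word j p′, of length N over α letters, has a bad factor; as p′
-- avoids them it is a prefix, and it is not an anti-power, since the map sending c to j
-- and agreeing with the relabelling elsewhere takes w onto j p′ and anti-powers pull back
-- along any letter map. So j p′ = (j u_j)^k x_j. The lengths |u_j| are distinct because
-- p′ has the letter j at position |u_j|; renaming the letters in the order of |u_j| gives
-- the word of (2). If the gcd bound failed for i < j, the prefix of p′ of length
-- |u_i| + (k−1)(|u_i|+1) would have the periods |u_i|+1 and |u_j|+1 and be at least as long
-- as their sum, hence (Fine–Wilf) the period g = gcd; as g divides |u_j| − |u_i|, the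
-- letters i and j at these positions would coincide.

module Submission where

open import Defs
open import Data.Nat using (ℕ; zero; suc; _+_; _*_; _∸_; _≤_; _<_; z≤n; s≤s; _<?_; _≤?_) renaming (_≟_ to _≟ℕ_)
open import Data.Nat.Properties hiding (_≟_)
open import Data.Nat.GCD using (gcd; gcd-GCD; gcd-comm; gcd-identityˡ; gcd-identityʳ; gcd[m,n]∣m; gcd[m,n]∣n; module GCD)
open import Data.Nat.Divisibility using (_∣_; divides; ∣⇒≤; ∣m+n∣m⇒∣n)
open import Data.Product using (∃; ∃-syntax; _×_; _,_; proj₁; proj₂)
open import Data.Sum using (_⊎_; inj₁; inj₂)
open import Data.Maybe using (Maybe; just; nothing; fromMaybe)
open import Data.Maybe.Properties using (just-injective)
open import Data.Fin as Fin using (Fin; toℕ)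
import Data.Fin.Properties as Fin
open import Data.Fin.Properties using (toℕ-inject≤; toℕ-fromℕ<; punchOut-injective; injective⇒≤)
open import Data.List using (List; []; _∷_; _++_; [_]; length; concat; replicate; take; drop; map; reverse; filter; allFin; lookup; deduplicate)
open import Data.List.Properties
  using ( ≡-dec; ++-assoc; ++-identityʳ; ∷-injectiveˡ; ∷-injectiveʳ; length-++; length-++-≤ˡ; length-++-≤ʳ
        ; map-++; map-∘; map-id-local; map-cong-local; length-map; map-replicate; concat-map; concat-++
        ; take++drop≡id; length-tabulate; filter-notAll
        ; reverse-++; reverse-involutive; reverse-injective; length-reverse; unfold-reverse )
open import Data.List.Membership.Propositional using (_∈_; _∉_)
open import Data.List.Membership.Propositional.Properties using (∈-++⁺ˡ; ∈-++⁺ʳ; ∈-allFin; ∈-lookup; ∈-deduplicate⁺)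
open import Data.List.Relation.Unary.Any as Any using (here; there)
import Data.List.Relation.Unary.Any.Properties as Any
open import Data.List.Relation.Unary.All as All using (All; []; _∷_)
import Data.List.Relation.Unary.All.Properties as All
open import Data.List.Relation.Unary.AllPairs using (_∷_)
open import Data.List.Relation.Unary.Unique.Propositional using (Unique)
import Data.List.Relation.Unary.Unique.Propositional.Properties as Unique
open import Data.List.Relation.Unary.Unique.DecPropositional.Properties using (deduplicate-!)
open import Data.List.Relation.Binary.Permutation.Propositional using (↭-sym; ↭⇒↭ₛ)
open import Data.List.Relation.Binary.Permutation.Propositional.Properties using (↭-reverse; All-resp-↭)
import Data.List.Relation.Binary.Permutation.Setoid.Properties as PermutationSetoid
open import Function using (_∘_)
open import Relation.Binary.PropositionalEquality hiding ([_])
open import Relation.Binary.Definitions using (DecidableEquality; tri<; tri≈; tri>)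
open import Relation.Nullary using (¬_; contradiction; Dec; yes; no; ¬?)
open import Relation.Nullary.Decidable using (map′; _×-dec_; _⊎-dec_)
open import Relation.Unary using (Decidable)

-- Factors, letter maps and reversal

IsPowerOrAntiPower : {A : Set} → ℕ → List A → Set
IsPowerOrAntiPower k f = IsPower k f ⊎ IsAntiPower k f

module _ {A : Set} where

  factor-trans : {f g w : List A} → Factor f g → Factor g w → Factor f w
  factor-trans {f} (p , s , refl) (p′ , s′ , refl) = p′ ++ p , s ++ s′ , (begin
      (p′ ++ p) ++ f ++ s ++ s′   ≡⟨ ++-assoc p′ p _ ⟩
      p′ ++ p ++ f ++ s ++ s′     ≡⟨ cong (λ t → p′ ++ p ++ t) (++-assoc f s s′) ⟨
      p′ ++ p ++ (f ++ s) ++ s′   ≡⟨ cong (p′ ++_) (++-assoc p (f ++ s) s′) ⟨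
      p′ ++ (p ++ f ++ s) ++ s′   ∎)
    where open ≡-Reasoning

  ∈-factor : {x : A} {f w : List A} → x ∈ f → Factor f w → x ∈ w
  ∈-factor x∈f (p , s , refl) = ∈-++⁺ʳ p (∈-++⁺ˡ x∈f)

  suffix-factor : (p f : List A) → Factor f (p ++ f)
  suffix-factor p f = p , [] , cong (p ++_) (++-identityʳ f)

  avoids-factor : ∀ {k} {g w : List A} → Avoids k w → Factor g w → Avoids k g
  avoids-factor avoids g⊑w f f⊑g = avoids f (factor-trans f⊑g g⊑w)

module _ {A B : Set} (φ : A → B) where

  map-++⁻ : (w : List A) (P Q : List B) → map φ w ≡ P ++ Q →
            ∃[ p ] ∃[ q ] (w ≡ p ++ q × map φ p ≡ P × map φ q ≡ Q)
  map-++⁻ w       []      Q eq = [] , w , refl , refl , eq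
  map-++⁻ (a ∷ w) (b ∷ P) Q eq with map-++⁻ w P Q (∷-injectiveʳ eq)
  ... | p , q , refl , refl , refl = a ∷ p , q , refl , cong (_∷ map φ p) (∷-injectiveˡ eq) , refl

  factor-map⁻ : ∀ {F w} → Factor F (map φ w) → ∃[ f ] (Factor f w × map φ f ≡ F)
  factor-map⁻ {F} {w} (P , S , eq) with map-++⁻ w P (F ++ S) (sym eq)
  ... | p , fs , refl , _ , eq′ with map-++⁻ fs F S eq′
  ... | f , s , refl , refl , _ = f , (p , s , refl) , refl

  map-concat⁻ : (f : List A) (bs : List (List B)) → map φ f ≡ concat bs →
                ∃[ as ] (f ≡ concat as × map (map φ) as ≡ bs)
  map-concat⁻ [] [] eq = [] , refl , refl
  map-concat⁻ f (b ∷ bs) eq with map-++⁻ f b (concat bs) eq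
  ... | p , q , refl , refl , eq′ with map-concat⁻ q bs eq′
  ... | as , refl , refl = p ∷ as , refl , refl

  map-concat-replicate : ∀ k (u : List A) → map φ (concat (replicate k u)) ≡ concat (replicate k (map φ u))
  map-concat-replicate k u = begin
    map φ (concat (replicate k u))          ≡⟨ concat-map (replicate k u) ⟨
    concat (map (map φ) (replicate k u))    ≡⟨ cong concat (map-replicate (map φ) k u) ⟩
    concat (replicate k (map φ u))          ∎
    where open ≡-Reasoning

  isPower-map : ∀ {k f} → IsPower k f → IsPower k (map φ f)
  isPower-map {k} (u@(_ ∷ _) , _ , refl) = map φ u , (λ ()) , map-concat-replicate k u
  isPower-map ([] , u≢[] , _) = contradiction refl u≢[]

  isAntiPower-map⁻ : ∀ {k f} → IsAntiPower k (map φ f) → IsAntiPower k f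
  isAntiPower-map⁻ {f = f} (bs , m , |bs|≡k , |b|≡m , unique , eq) with map-concat⁻ f bs eq
  ... | as , f≡as , refl =
    as , m , trans (sym (length-map (map φ) as)) |bs|≡k ,
    All.map (λ {a} |φa|≡m → trans (sym (length-map φ a)) |φa|≡m) (All.map⁻ |b|≡m) ,
    Unique.map⁻ unique , f≡as

module _ {A B : Set} (φ : A → B) (ψ : B → A) where

  map-leftInverse : (f : List A) → (∀ {x} → x ∈ f → ψ (φ x) ≡ x) → map ψ (map φ f) ≡ f
  map-leftInverse f inv = trans (sym (map-∘ f)) (map-id-local (All.tabulate inv))

  avoids-map : ∀ {k} (w : List A) → (∀ {x} → x ∈ w → ψ (φ x) ≡ x) → Avoids k w → Avoids k (map φ w)
  avoids-map {k} w inv avoids F F⊑φw bad with factor-map⁻ φ F⊑φw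
  ... | f , f⊑w , refl = avoids f f⊑w (pull-back bad)
    where
    pull-back : IsPowerOrAntiPower k (map φ f) → IsPowerOrAntiPower k f
    pull-back (inj₁ power)     = inj₁ (subst (IsPower k) (map-leftInverse f (λ x∈f → inv (∈-factor x∈f f⊑w))) (isPower-map ψ {k} power))
    pull-back (inj₂ antiPower) = inj₂ (isAntiPower-map⁻ φ antiPower)

module _ {A : Set} where

  factor-reverse : {f w : List A} → Factor f (reverse w) → Factor (reverse f) w
  factor-reverse {f} {w} (p , s , eq) = reverse s , reverse p , (begin
      reverse s ++ reverse f ++ reverse p   ≡⟨ ++-assoc (reverse s) (reverse f) (reverse p) ⟨
      (reverse s ++ reverse f) ++ reverse p ≡⟨ cong (_++ reverse p) (reverse-++ f s) ⟨
      reverse (f ++ s) ++ reverse p         ≡⟨ reverse-++ p (f ++ s) ⟨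
      reverse (p ++ f ++ s)                 ≡⟨ cong reverse eq ⟩
      reverse (reverse w)                   ≡⟨ reverse-involutive w ⟩
      w                                     ∎)
    where open ≡-Reasoning

  concat-replicate-comm : ∀ k (u : List A) → concat (replicate k u) ++ u ≡ u ++ concat (replicate k u)
  concat-replicate-comm zero    u = sym (++-identityʳ u)
  concat-replicate-comm (suc k) u = trans (++-assoc u _ u) (cong (u ++_) (concat-replicate-comm k u))

  reverse-concat-replicate : ∀ k (u : List A) → reverse (concat (replicate k u)) ≡ concat (replicate k (reverse u))
  reverse-concat-replicate zero    u = refl
  reverse-concat-replicate (suc k) u = begin
    reverse (u ++ concat (replicate k u))                 ≡⟨ reverse-++ u _ ⟩
    reverse (concat (replicate k u)) ++ reverse u         ≡⟨ cong (_++ reverse u) (reverse-concat-replicate k u) ⟩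
    concat (replicate k (reverse u)) ++ reverse u         ≡⟨ concat-replicate-comm k (reverse u) ⟩
    reverse u ++ concat (replicate k (reverse u))         ∎
    where open ≡-Reasoning

  reverse-concat : (bs : List (List A)) → reverse (concat bs) ≡ concat (reverse (map reverse bs))
  reverse-concat []       = refl
  reverse-concat (b ∷ bs) = begin
    reverse (b ++ concat bs)                                 ≡⟨ reverse-++ b (concat bs) ⟩
    reverse (concat bs) ++ reverse b                         ≡⟨ cong (_++ reverse b) (reverse-concat bs) ⟩
    concat (reverse (map reverse bs)) ++ reverse b           ≡⟨ cong (concat (reverse (map reverse bs)) ++_) (++-identityʳ (reverse b)) ⟨
    concat (reverse (map reverse bs)) ++ concat [ reverse b ] ≡⟨ concat-++ (reverse (map reverse bs)) [ reverse b ] ⟩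
    concat (reverse (map reverse bs) ++ [ reverse b ])       ≡⟨ cong concat (unfold-reverse (reverse b) (map reverse bs)) ⟨
    concat (reverse (map reverse (b ∷ bs)))                  ∎
    where open ≡-Reasoning

  isPower-reverse : ∀ {k} {f : List A} → IsPower k f → IsPower k (reverse f)
  isPower-reverse {k} (u , u≢[] , refl) =
    reverse u , (λ eq → u≢[] (reverse-injective eq)) , reverse-concat-replicate k u

  isAntiPower-reverse : ∀ {k} {f : List A} → IsAntiPower k f → IsAntiPower k (reverse f)
  isAntiPower-reverse (bs , m , |bs|≡k , |b|≡m , unique , refl) =
    reverse (map reverse bs) , m ,
    trans (length-reverse (map reverse bs)) (trans (length-map reverse bs) |bs|≡k) ,
    All-resp-↭ (↭-sym (↭-reverse _)) (All.map⁺ (All.map (λ {b} |b|≡m → trans (length-reverse b) |b|≡m) |b|≡m)) ,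
    PermutationSetoid.Unique-resp-↭ (setoid (List A)) (↭⇒↭ₛ (↭-sym (↭-reverse _))) (Unique.map⁺ reverse-injective unique) ,
    reverse-concat bs

  avoids-reverse : ∀ {k} (w : List A) → Avoids k w → Avoids k (reverse w)
  avoids-reverse {k} w avoids f f⊑rw bad = avoids (reverse f) (factor-reverse f⊑rw) (reverse-bad bad)
    where
    reverse-bad : IsPowerOrAntiPower k f → IsPowerOrAntiPower k (reverse f)
    reverse-bad (inj₁ power)     = inj₁ (isPower-reverse {k} power)
    reverse-bad (inj₂ antiPower) = inj₂ (isAntiPower-reverse antiPower)

-- Deciding avoidance

module _ {A : Set} where

  take-length-++ : (u v : List A) → take (length u) (u ++ v) ≡ u
  take-length-++ []      v = refl
  take-length-++ (x ∷ u) v = cong (x ∷_) (take-length-++ u v)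

  drop-length-++ : (u v : List A) → drop (length u) (u ++ v) ≡ v
  drop-length-++ []      v = refl
  drop-length-++ (x ∷ u) v = drop-length-++ u v

  chunks : ℕ → ℕ → List A → List (List A)
  chunks zero    m f = []
  chunks (suc k) m f = take m f ∷ chunks k m (drop m f)

  length-chunks : ∀ k m f → length (chunks k m f) ≡ k
  length-chunks zero    m f = refl
  length-chunks (suc k) m f = cong suc (length-chunks k m (drop m f))

  chunks-concat : ∀ m (bs : List (List A)) → All (λ b → length b ≡ m) bs →
                  chunks (length bs) m (concat bs) ≡ bs
  chunks-concat m []       []         = refl
  chunks-concat m (b ∷ bs) (refl ∷ |bs|≡m) = cong₂ _∷_ (take-length-++ b (concat bs)) (begin
    chunks (length bs) m (drop m (b ++ concat bs)) ≡⟨ cong (chunks (length bs) m) (drop-length-++ b (concat bs)) ⟩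
    chunks (length bs) m (concat bs)               ≡⟨ chunks-concat m bs |bs|≡m ⟩
    bs                                             ∎)
    where open ≡-Reasoning

module _ {A : Set} (_≟_ : DecidableEquality A) where
  open import Data.List.Relation.Unary.Unique.DecPropositional (≡-dec _≟_) using (unique?)

  isPower? : ∀ k (f : List A) → Dec (IsPower (suc k) f)
  isPower? k f = map′ fromFound toFound
    (anyUpTo? (λ l → ¬? (l ≟ℕ 0) ×-dec ≡-dec _≟_ f (power l)) (suc (length f)))
    where
    power : ℕ → List A
    power l = concat (replicate (suc k) (take l f))
    Found : Set
    Found = ∃[ l ] (l < suc (length f) × l ≢ 0 × f ≡ power l)
    take-nonempty : ∀ l (f : List A) → l < suc (length f) → l ≢ 0 → take l f ≢ []
    take-nonempty zero    f       _         l≢0 _ = l≢0 refl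
    take-nonempty (suc l) []      (s≤s ())  _
    take-nonempty (suc l) (x ∷ f) _         _   ()
    fromFound : Found → IsPower (suc k) f
    fromFound (l , l<1+|f| , l≢0 , eq) = take l f , take-nonempty l f l<1+|f| l≢0 , eq
    toFound : IsPower (suc k) f → Found
    toFound (u@(_ ∷ _) , _ , refl) = length u , s≤s (length-++-≤ˡ u) , (λ ()) ,
      cong (concat ∘ replicate (suc k)) (sym (take-length-++ u _))
    toFound ([] , []≢[] , _) = contradiction refl []≢[]

  isAntiPower? : ∀ k (f : List A) → Dec (IsAntiPower (suc k) f)
  isAntiPower? k f = map′ fromFound toFound
    (anyUpTo? (λ m → All.all? (λ b → length b ≟ℕ m) (blocks m) ×-dec unique? (blocks m) ×-dec ≡-dec _≟_ f (concat (blocks m)))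
              (suc (length f)))
    where
    blocks : ℕ → List (List A)
    blocks m = chunks (suc k) m f
    Found : Set
    Found = ∃[ m ] (m < suc (length f) × All (λ b → length b ≡ m) (blocks m) × Unique (blocks m) × f ≡ concat (blocks m))
    fromFound : Found → IsAntiPower (suc k) f
    fromFound (m , _ , |b|≡m , unique , eq) = blocks m , m , length-chunks (suc k) m f , |b|≡m , unique , eq
    toFound : IsAntiPower (suc k) f → Found
    toFound (b ∷ bs , m , |bs|≡k , |b|≡m@(refl ∷ _) , unique , refl) =
      m , s≤s (length-++-≤ˡ b) ,
      subst (All (λ b → length b ≡ m)) (sym blocks≡) |b|≡m , subst Unique (sym blocks≡) unique , cong concat (sym blocks≡)
      where
      blocks≡ : blocks m ≡ b ∷ bs
      blocks≡ = subst (λ j → chunks j m (concat (b ∷ bs)) ≡ b ∷ bs) |bs|≡k (chunks-concat m (b ∷ bs) |b|≡m)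

  isPowerOrAntiPower? : ∀ k (f : List A) → Dec (IsPowerOrAntiPower (suc k) f)
  isPowerOrAntiPower? k f = isPower? k f ⊎-dec isAntiPower? k f

  avoids? : ∀ k (w : List A) → Dec (Avoids (suc k) w)
  avoids? k w = map′ avoids noFactorAt
    (allUpTo? (λ i → allUpTo? (λ l → ¬? (isPowerOrAntiPower? k (take l (drop i w)))) (suc (length w))) (suc (length w)))
    where
    NoFactorAt : Set
    NoFactorAt = ∀ {i} → i < suc (length w) → ∀ {l} → l < suc (length w) → ¬ IsPowerOrAntiPower (suc k) (take l (drop i w))
    avoids : NoFactorAt → Avoids (suc k) w
    avoids none f (p , s , refl) = subst (¬_ ∘ IsPowerOrAntiPower (suc k)) f-at
      (none (s≤s (length-++-≤ˡ p)) (s≤s (≤-trans (length-++-≤ˡ f) (length-++-≤ʳ (f ++ s) {p}))))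
      where
      f-at : take (length f) (drop (length p) (p ++ f ++ s)) ≡ f
      f-at = trans (cong (take (length f)) (drop-length-++ p (f ++ s))) (take-length-++ f s)
    noFactorAt : Avoids (suc k) w → NoFactorAt
    noFactorAt avoiding {i} _ {l} _ = avoiding (take l (drop i w)) (take i w , drop l (drop i w) ,
      trans (cong (take i w ++_) (take++drop≡id l (drop i w))) (take++drop≡id i w))

∀⊎∃-Fin : ∀ {β} {P Q : Fin β → Set} → (∀ a → P a ⊎ Q a) → (∀ a → P a) ⊎ ∃ Q
∀⊎∃-Fin {zero}  _      = inj₁ (λ ())
∀⊎∃-Fin {suc β} P⊎Q with P⊎Q Fin.zero | ∀⊎∃-Fin (P⊎Q ∘ Fin.suc)
... | inj₂ q | _            = inj₂ (Fin.zero , q)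
... | inj₁ _ | inj₂ (a , q) = inj₂ (Fin.suc a , q)
... | inj₁ p | inj₁ ps      = inj₁ λ { Fin.zero → p ; (Fin.suc a) → ps a }

∀⊎∃-Word : ∀ {β} {P Q : Word β → Set} → (∀ w → P w ⊎ Q w) →
           ∀ n → (∀ w → length w ≡ n → P w) ⊎ ∃[ w ] (length w ≡ n × Q w)
∀⊎∃-Word P⊎Q zero with P⊎Q []
... | inj₁ p = inj₁ λ { [] refl → p }
... | inj₂ q = inj₂ ([] , refl , q)
∀⊎∃-Word P⊎Q (suc n) with ∀⊎∃-Fin (λ a → ∀⊎∃-Word (P⊎Q ∘ (a ∷_)) n)
... | inj₁ ps                = inj₁ λ { (a ∷ w) |w|≡n → ps a w (suc-injective |w|≡n) }
... | inj₂ (a , w , refl , q) = inj₂ (a ∷ w , refl , q)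

-- Relabelling letters

module _ {A : Set} where

  at : List A → ℕ → Maybe A
  at []       _       = nothing
  at (x ∷ xs) zero    = just x
  at (x ∷ xs) (suc i) = at xs i

  at-++ˡ : ∀ (xs ys : List A) {i} → i < length xs → at (xs ++ ys) i ≡ at xs i
  at-++ˡ (x ∷ xs) ys {zero}  _         = refl
  at-++ˡ (x ∷ xs) ys {suc i} (s≤s i<n) = at-++ˡ xs ys i<n

  at-++ʳ : ∀ (xs ys : List A) i → at (xs ++ ys) (length xs + i) ≡ at ys i
  at-++ʳ []       ys i = refl
  at-++ʳ (x ∷ xs) ys i = at-++ʳ xs ys i

  at-index : ∀ {x} {xs : List A} (x∈xs : x ∈ xs) → at xs (toℕ (Any.index x∈xs)) ≡ just x
  at-index (here refl)  = refl
  at-index (there x∈xs) = at-index x∈xs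

module _ {A : Set} (_≟_ : DecidableEquality A) (default : A) (d : List A) where
  open import Data.List.Membership.DecPropositional _≟_ using (_∈?_)

  encode : ∀ {γ} → length d ≤ suc γ → A → Fin (suc γ)
  encode |d|≤γ x with x ∈? d
  ... | yes x∈d = Fin.inject≤ (Any.index x∈d) |d|≤γ
  ... | no  _   = Fin.zero

  decode : ∀ {γ} → Fin γ → A
  decode y = fromMaybe default (at d (toℕ y))

  decode-encode : ∀ {γ} (|d|≤γ : length d ≤ suc γ) {x} → x ∈ d → decode (encode |d|≤γ x) ≡ x
  decode-encode |d|≤γ {x} x∈d with x ∈? d
  ... | yes x∈d′ = cong (fromMaybe default) (trans (cong (at d) (toℕ-inject≤ _ |d|≤γ)) (at-index x∈d′))
  ... | no  x∉d  = contradiction x∈d x∉d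

lookup-injective : ∀ {A : Set} {xs : List A} → Unique xs → ∀ {i j} → lookup xs i ≡ lookup xs j → i ≡ j
lookup-injective {xs = _ ∷ _} _            {Fin.zero}  {Fin.zero}  _  = refl
lookup-injective {xs = _ ∷ _} (x∉xs ∷ _)   {Fin.zero}  {Fin.suc j} eq = contradiction eq (All.lookup x∉xs (∈-lookup j))
lookup-injective {xs = _ ∷ _} (x∉xs ∷ _)   {Fin.suc i} {Fin.zero}  eq = contradiction (sym eq) (All.lookup x∉xs (∈-lookup i))
lookup-injective {xs = _ ∷ _} (_ ∷ unique) {Fin.suc i} {Fin.suc j} eq = cong Fin.suc (lookup-injective unique eq)

module _ {β : ℕ} where

  length-unique-≤ : ∀ {xs : List (Fin β)} → Unique xs → length xs ≤ β
  length-unique-≤ unique = injective⇒≤ (lookup-injective unique)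

  distinctLetters-≤ : (w : Word β) → distinctLetters w ≤ β
  distinctLetters-≤ w = length-unique-≤ (deduplicate-! Fin._≟_ w)

module _ {X : Set} {P Q : X → Set} (P? : Decidable P) (Q? : Decidable Q) (P⇒Q : ∀ {x} → P x → Q x) where

  length-filter-mono : ∀ xs → length (filter P? xs) ≤ length (filter Q? xs)
  length-filter-mono []       = z≤n
  length-filter-mono (x ∷ xs) with P? x | Q? x
  ... | yes _  | yes _  = s≤s (length-filter-mono xs)
  ... | yes px | no ¬qx = contradiction (P⇒Q px) ¬qx
  ... | no _   | yes _  = m≤n⇒m≤1+n (length-filter-mono xs)
  ... | no _   | no _   = length-filter-mono xs

  length-filter-< : ∀ {xs y} → y ∈ xs → Q y → ¬ P y → length (filter P? xs) < length (filter Q? xs)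
  length-filter-< {x ∷ xs} y∈xs qy ¬py with P? x | Q? x | y∈xs
  ... | yes px | no ¬qx | _          = contradiction (P⇒Q px) ¬qx
  ... | yes px | yes _  | here refl  = contradiction px ¬py
  ... | no _   | no ¬qx | here refl  = contradiction qy ¬qx
  ... | no _   | yes _  | here refl  = s≤s (length-filter-mono xs)
  ... | yes _  | yes _  | there y∈  = s≤s (length-filter-< y∈ qy ¬py)
  ... | no _   | yes _  | there y∈  = m<n⇒m<1+n (length-filter-< y∈ qy ¬py)
  ... | no _   | no _   | there y∈  = length-filter-< y∈ qy ¬py

injective⇒surjective : ∀ {n} {f : Fin n → Fin n} → (∀ {i j} → f i ≡ f j → i ≡ j) → ∀ t → ∃[ j ] (f j ≡ t)
injective⇒surjective {suc n} {f} f-injective t with Fin.any? (λ j → f j Fin.≟ t)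
... | yes hit = hit
... | no  miss = contradiction (injective⇒≤ punchOut-f-injective) 1+n≰n
  where
  t≢f : ∀ j → t ≢ f j
  t≢f j t≡fj = miss (j , sym t≡fj)
  punchOut-f-injective : ∀ {i j} → Fin.punchOut (t≢f i) ≡ Fin.punchOut (t≢f j) → i ≡ j
  punchOut-f-injective eq = f-injective (punchOut-injective (t≢f _) (t≢f _) eq)

module Sort {α} (ℓ : Fin α → ℕ) (ℓ-injective : ∀ {i j} → ℓ i ≡ ℓ j → i ≡ j) where

  rank : Fin α → ℕ
  rank j = length (filter (λ i → ℓ i <? ℓ j) (allFin α))

  rank<α : ∀ j → rank j < α
  rank<α j = subst (rank j <_) (length-tabulate {n = α} (λ i → i))
    (filter-notAll (λ i → ℓ i <? ℓ j) (allFin α) (Any.map (λ { refl → <-irrefl refl }) (∈-allFin j)))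

  rank-mono : ∀ {i j} → ℓ i < ℓ j → rank i < rank j
  rank-mono {i} {j} ℓi<ℓj = length-filter-< (λ x → ℓ x <? ℓ i) (λ x → ℓ x <? ℓ j) (λ ℓx<ℓi → <-trans ℓx<ℓi ℓi<ℓj)
    (∈-allFin i) ℓi<ℓj (<-irrefl refl)

  sort : Fin α → Fin α
  sort j = Fin.fromℕ< (rank<α j)

  sort-mono : ∀ {i j} → ℓ i < ℓ j → sort i Fin.< sort j
  sort-mono {i} {j} ℓi<ℓj = subst₂ _<_ (sym (toℕ-fromℕ< (rank<α i))) (sym (toℕ-fromℕ< (rank<α j))) (rank-mono ℓi<ℓj)

  sort-injective : ∀ {i j} → sort i ≡ sort j → i ≡ j
  sort-injective {i} {j} eq with <-cmp (ℓ i) (ℓ j)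
  ... | tri< ℓi<ℓj _ _ = contradiction (cong toℕ eq) (<⇒≢ (sort-mono ℓi<ℓj))
  ... | tri≈ _ ℓi≡ℓj _ = ℓ-injective ℓi≡ℓj
  ... | tri> _ _ ℓj<ℓi = contradiction (cong toℕ (sym eq)) (<⇒≢ (sort-mono ℓj<ℓi))

  sort-reflects-< : ∀ {i j} → sort i Fin.< sort j → ℓ i < ℓ j
  sort-reflects-< {i} {j} lt with <-cmp (ℓ i) (ℓ j)
  ... | tri< ℓi<ℓj _ _ = ℓi<ℓj
  ... | tri≈ _ ℓi≡ℓj _ = contradiction (cong (toℕ ∘ sort) (ℓ-injective ℓi≡ℓj)) (<⇒≢ lt)
  ... | tri> _ _ ℓj<ℓi = contradiction lt (<-asym (sort-mono ℓj<ℓi))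

-- Periods

gcd[m,m+n]≡gcd[m,n] : ∀ m n → gcd m (m + n) ≡ gcd m n
gcd[m,m+n]≡gcd[m,n] m n = GCD.unique (gcd-GCD m (m + n)) (GCD.step (gcd-GCD m n))

module _ {A : Set} where

  Periodic : ℕ → ℕ → List A → Set
  Periodic L p z = ∀ x → x + p < L → at z x ≡ at z (x + p)

  periodic-≤ : ∀ {L L′ p} {z : List A} → L′ ≤ L → Periodic L p z → Periodic L′ p z
  periodic-≤ L′≤L periodic x x+p<L′ = periodic x (<-≤-trans x+p<L′ L′≤L)

  periodic-++ : ∀ {L p} {z : List A} y → L ≤ length z → Periodic L p z → Periodic L p (z ++ y)
  periodic-++ {p = p} {z} y L≤|z| periodic x x+p<L = begin
    at (z ++ y) x       ≡⟨ at-++ˡ z y (≤-<-trans (m≤m+n x p) (<-≤-trans x+p<L L≤|z|)) ⟩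
    at z x              ≡⟨ periodic x x+p<L ⟩
    at z (x + p)        ≡⟨ at-++ˡ z y (<-≤-trans x+p<L L≤|z|) ⟨
    at (z ++ y) (x + p) ∎
    where open ≡-Reasoning

  periodic-overlap : (v z y : List A) → v ++ z ≡ z ++ y → Periodic (length v + length z) (length v) (v ++ z)
  periodic-overlap v z y v++z≡z++y x x+|v|<L = begin
    at (v ++ z) x              ≡⟨ cong (λ t → at t x) v++z≡z++y ⟩
    at (z ++ y) x              ≡⟨ at-++ˡ z y (+-cancelˡ-< (length v) x _ (subst (_< length v + length z) (+-comm x (length v)) x+|v|<L)) ⟩
    at z x                     ≡⟨ at-++ʳ v z x ⟨
    at (v ++ z) (length v + x) ≡⟨ cong (at (v ++ z)) (+-comm (length v) x) ⟩
    at (v ++ z) (x + length v) ∎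
    where open ≡-Reasoning

  periodic-multiple : ∀ {L p} {z : List A} → Periodic L p z → ∀ t x → x + t * p < L → at z x ≡ at z (x + t * p)
  periodic-multiple {z = z} periodic zero    x _ = cong (at z) (sym (+-identityʳ x))
  periodic-multiple {L} {p} {z} periodic (suc t) x x+tp<L = begin
    at z x                  ≡⟨ periodic x (≤-<-trans (+-monoʳ-≤ x (m≤m+n p (t * p))) x+tp<L) ⟩
    at z (x + p)            ≡⟨ periodic-multiple {z = z} periodic t (x + p) (subst (_< L) (sym (+-assoc x p (t * p))) x+tp<L) ⟩
    at z (x + p + t * p)    ≡⟨ cong (at z) (+-assoc x p (t * p)) ⟩
    at z (x + (p + t * p))  ∎
    where open ≡-Reasoning

  periodic-∣ : ∀ {L g d} {z : List A} → Periodic L g z → g ∣ d → ∀ x → x + d < L → at z x ≡ at z (x + d)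
  periodic-∣ {z = z} periodic (divides t refl) x x+d<L = periodic-multiple {z = z} periodic t x x+d<L

  periodic-difference : ∀ {L p r} {z : List A} → p + (p + r) ≤ L →
                        Periodic L p z → Periodic L (p + r) z → Periodic L r z
  periodic-difference {L} {p} {r} {z} p+q≤L periodic-p periodic-q x x+r<L with x + (p + r) <? L
  ... | yes x+q<L = begin
    at z x               ≡⟨ periodic-q x x+q<L ⟩
    at z (x + (p + r))   ≡⟨ cong (at z) (x+[p+r]≡x+r+p x) ⟩
    at z (x + r + p)     ≡⟨ periodic-p (x + r) (subst (_< L) (x+[p+r]≡x+r+p x) x+q<L) ⟨
    at z (x + r)         ∎
    where open ≡-Reasoning
          x+[p+r]≡x+r+p : ∀ x → x + (p + r) ≡ x + r + p
          x+[p+r]≡x+r+p x = trans (cong (x +_) (+-comm p r)) (sym (+-assoc x r p))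
  ... | no x+q≮L with m≤n⇒∃[o]m+o≡n (+-cancelʳ-≤ (p + r) p x (≤-trans p+q≤L (≮⇒≥ x+q≮L)))
  ...   | y , refl = begin
    at z (p + y)         ≡⟨ cong (at z) (+-comm p y) ⟩
    at z (y + p)         ≡⟨ periodic-p y (subst (_< L) (+-comm p y) (≤-<-trans (m≤m+n (p + y) r) x+r<L)) ⟨
    at z y               ≡⟨ periodic-q y (subst (_< L) (sym y+[p+r]≡p+y+r) x+r<L) ⟩
    at z (y + (p + r))   ≡⟨ cong (at z) y+[p+r]≡p+y+r ⟩
    at z (p + y + r)     ∎
    where open ≡-Reasoning
          y+[p+r]≡p+y+r : y + (p + r) ≡ p + y + r
          y+[p+r]≡p+y+r = trans (sym (+-assoc y p r)) (cong (_+ r) (+-comm y p))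

  -- A weak Fine–Wilf theorem, by Euclid's algorithm on the two periods.
  periodic-gcd : ∀ {L} {z : List A} p q → p + q ≤ L → Periodic L p z → Periodic L q z → Periodic L (gcd p q) z
  periodic-gcd {L} {z} p q = euclid (p + q) p q ≤-refl
    where
    euclid : ∀ n p q → p + q ≤ n → p + q ≤ L → Periodic L p z → Periodic L q z → Periodic L (gcd p q) z
    reduce : ∀ n a b → 0 < a → a ≤ b → a + b ≤ suc n → a + b ≤ L → Periodic L a z → Periodic L b z → Periodic L (gcd a b) z

    euclid _       zero    q       _     _     _         periodic-q =
      subst (λ g → Periodic L g z) (sym (gcd-identityˡ q)) periodic-q
    euclid _       (suc p) zero    _     _     periodic-p _          =
      subst (λ g → Periodic L g z) (sym (gcd-identityʳ (suc p))) periodic-p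
    euclid (suc n) (suc p) (suc q) bound p+q≤L periodic-p periodic-q with ≤-total p q
    ... | inj₁ p≤q = reduce n (suc p) (suc q) (s≤s z≤n) (s≤s p≤q) bound p+q≤L periodic-p periodic-q
    ... | inj₂ q≤p = subst (λ g → Periodic L g z) (gcd-comm (suc q) (suc p))
      (reduce n (suc q) (suc p) (s≤s z≤n) (s≤s q≤p) (subst (_≤ suc n) (+-comm (suc p) (suc q)) bound)
        (subst (_≤ L) (+-comm (suc p) (suc q)) p+q≤L) periodic-q periodic-p)

    reduce n a b 0<a a≤b bound a+b≤L periodic-a periodic-b with m≤n⇒∃[o]m+o≡n a≤b
    ... | r , refl = subst (λ g → Periodic L g z) (sym (gcd[m,m+n]≡gcd[m,n] a r))
      (euclid n a r a+r≤n (≤-trans (m≤n+m (a + r) a) a+b≤L) periodic-a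
        (periodic-difference {z = z} a+b≤L periodic-a periodic-b))
      where
      a+r≤n : a + r ≤ n
      a+r≤n = ≤-pred (≤-trans (+-monoˡ-≤ (a + r) 0<a) bound)

module _ {A : Set} where

  at-length-++-∷ : ∀ (u : List A) a v → at (u ++ a ∷ v) (length u) ≡ just a
  at-length-++-∷ []      a v = refl
  at-length-++-∷ (_ ∷ u) a v = at-length-++-∷ u a v

  length-concat-replicate : ∀ r (u : List A) → length (concat (replicate r u)) ≡ r * length u
  length-concat-replicate zero    u = refl
  length-concat-replicate (suc r) u = trans (length-++ u) (cong (length u +_) (length-concat-replicate r u))

  periodic-power : ∀ r (u : List A) a → let w = u ++ concat (replicate r (a ∷ u)) in
                   Periodic (length w) (suc (length u)) w
  periodic-power zero    u a x x+p<L =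
    contradiction (≤-trans (m≤n+m (suc (length u)) x) (<⇒≤ (subst (x + suc (length u) <_) |u++[]|≡|u| x+p<L))) 1+n≰n
    where
    |u++[]|≡|u| : length (u ++ []) ≡ length u
    |u++[]|≡|u| = cong length (++-identityʳ u)
  periodic-power (suc r) u a =
    subst (λ w → Periodic (length w) (suc (length u)) w) (++-assoc u [ a ] z)
      (subst₂ (λ L p → Periodic L p (v ++ z)) (sym (length-++ v)) |v|≡1+|u| (periodic-overlap v z (a ∷ u) v++z≡z++y))
    where
    v z : List A
    v = u ++ [ a ]
    z = u ++ concat (replicate r (a ∷ u))
    |v|≡1+|u| : length v ≡ suc (length u)
    |v|≡1+|u| = trans (length-++ u) (+-comm (length u) 1)
    v++z≡z++y : v ++ z ≡ z ++ a ∷ u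
    v++z≡z++y = begin
      (u ++ [ a ]) ++ z                              ≡⟨ ++-assoc u [ a ] z ⟩
      u ++ (a ∷ u) ++ concat (replicate r (a ∷ u))   ≡⟨ cong (u ++_) (concat-replicate-comm r (a ∷ u)) ⟨
      u ++ concat (replicate r (a ∷ u)) ++ a ∷ u     ≡⟨ ++-assoc u _ (a ∷ u) ⟨
      z ++ a ∷ u                                     ∎
      where open ≡-Reasoning

  periodic-shape : ∀ {z} r (u : List A) a x → z ≡ u ++ concat (replicate r (a ∷ u)) ++ x →
                   Periodic (length u + r * suc (length u)) (suc (length u)) z
  periodic-shape r u a x refl =
    subst₂ (λ L t → Periodic L (suc (length u)) t) |w|≡ (++-assoc u _ x)
      (periodic-++ {z = u ++ concat (replicate r (a ∷ u))} x ≤-refl (periodic-power r u a))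
    where
    |w|≡ : length (u ++ concat (replicate r (a ∷ u))) ≡ length u + r * suc (length u)
    |w|≡ = trans (length-++ u) (cong (length u +_) (length-concat-replicate r (a ∷ u)))

  at-shape : ∀ {z} K (u : List A) a x → z ≡ u ++ concat (replicate (suc K) (a ∷ u)) ++ x → at z (length u) ≡ just a
  at-shape K u a x refl = at-length-++-∷ u a _

  gcd-bound : ∀ {z} K (u v x y : List A) {a b} → a ≢ b → length u < length v →
              z ≡ u ++ concat (replicate (suc K) (a ∷ u)) ++ x →
              z ≡ v ++ concat (replicate (suc K) (b ∷ v)) ++ y →
              gcd (suc (length u)) (suc (length v)) * suc K ≤ suc (length v)
  gcd-bound {z} K u v x y {a} {b} a≢b |u|<|v| z≡u⋯ z≡v⋯ with gcd (suc (length u)) (suc (length v)) * suc K ≤? suc (length v)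
  ... | yes bound = bound
  ... | no ¬bound = contradiction (just-injective (begin
        just a              ≡⟨ at-shape K u a x z≡u⋯ ⟨
        at z (length u)     ≡⟨ periodic-∣ {z = z} periodic-g g∣d (length u) (subst (_< L) (sym |u|+d≡|v|) |v|<L) ⟩
        at z (length u + d) ≡⟨ cong (at z) |u|+d≡|v| ⟩
        at z (length v)     ≡⟨ at-shape K v b y z≡v⋯ ⟩
        just b              ∎)) a≢b
    where
    open ≡-Reasoning
    m n g L : ℕ
    m = suc (length u)
    n = suc (length v)
    g = gcd m n
    L = length u + suc K * m
    n<[1+K]m : n < suc K * m
    n<[1+K]m = ≤-trans (≰⇒> ¬bound) (≤-trans (*-monoˡ-≤ (suc K) (∣⇒≤ (gcd[m,n]∣m m n))) (≤-reflexive (*-comm m (suc K))))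
    |v|<L : length v < L
    |v|<L = ≤-trans (≤-trans (n≤1+n n) n<[1+K]m) (m≤n+m _ (length u))
    m+n≤L : m + n ≤ L
    m+n≤L = subst (_≤ L) (+-suc (length u) n) (+-monoʳ-≤ (length u) n<[1+K]m)
    periodic-m : Periodic L m z
    periodic-m = periodic-shape (suc K) u a x z≡u⋯
    periodic-n : Periodic L n z
    periodic-n = periodic-≤ {z = z} (+-mono-≤ (<⇒≤ |u|<|v|) (*-monoʳ-≤ (suc K) (s≤s (<⇒≤ |u|<|v|))))
                   (periodic-shape (suc K) v b y z≡v⋯)
    periodic-g : Periodic L g z
    periodic-g = periodic-gcd {z = z} m n m+n≤L periodic-m periodic-n
    d : ℕ
    d = proj₁ (m≤n⇒∃[o]m+o≡n (<⇒≤ |u|<|v|))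
    |u|+d≡|v| : length u + d ≡ length v
    |u|+d≡|v| = proj₂ (m≤n⇒∃[o]m+o≡n (<⇒≤ |u|<|v|))
    g∣d : g ∣ d
    g∣d = ∣m+n∣m⇒∣n (subst (g ∣_) (cong suc (sym |u|+d≡|v|)) (gcd[m,n]∣n m n)) (gcd[m,n]∣m m n)

module _ {A : Set} where

  -- a ∷ w begins with (a ∷ u)^(1+r): the shape of the words in alternative (2).
  PowerShaped : ℕ → A → List A → Set
  PowerShaped r a w = ∃[ u ] ∃[ x ] (w ≡ u ++ concat (replicate r (a ∷ u)) ++ x)

module _ {A B : Set} (g : A → B) where

  map-shape : ∀ r {w u a x} → w ≡ u ++ concat (replicate r (a ∷ u)) ++ x →
              map g w ≡ map g u ++ concat (replicate r (g a ∷ map g u)) ++ map g x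
  map-shape r {u = u} {a} {x} refl = begin
    map g (u ++ concat (replicate r (a ∷ u)) ++ x)                 ≡⟨ map-++ g u _ ⟩
    map g u ++ map g (concat (replicate r (a ∷ u)) ++ x)           ≡⟨ cong (map g u ++_) (map-++ g (concat (replicate r (a ∷ u))) x) ⟩
    map g u ++ map g (concat (replicate r (a ∷ u))) ++ map g x     ≡⟨ cong (λ t → map g u ++ t ++ map g x) (map-concat-replicate g r (a ∷ u)) ⟩
    map g u ++ concat (replicate r (g a ∷ map g u)) ++ map g x     ∎
    where open ≡-Reasoning

  powerShaped-of-image : ∀ K {w a v} → Avoids (suc K) w → map g w ≡ a ∷ v → Avoids (suc K) v →
                         ∃[ F ] (Factor F (a ∷ v) × IsPowerOrAntiPower (suc K) F) → PowerShaped K a v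
  powerShaped-of-image K avoids-w _ avoids-v (F , (_ ∷ P , S , eq) , bad) = contradiction bad (avoids-v F (P , S , ∷-injectiveʳ eq))
  powerShaped-of-image K {w} avoids-w gw≡av _ (F , ([] , S , eq) , inj₂ antiPower) with map-++⁻ g w F S (trans gw≡av (sym eq))
  ... | f , s , refl , refl , _ = contradiction (inj₂ (isAntiPower-map⁻ g antiPower)) (avoids-w f ([] , s , refl))
  powerShaped-of-image K _ _ _ (_ , ([] , _ , _) , inj₁ ([] , []≢[] , _)) = contradiction refl []≢[]
  powerShaped-of-image K _ _ _ (_ , ([] , S , eq) , inj₁ (b ∷ u , _ , refl)) with ∷-injectiveˡ eq
  ... | refl = u , S , trans (sym (∷-injectiveʳ eq)) (++-assoc u _ S)

alt2-of-powerShapes : ∀ {α} K (v : Word α) → Avoids (suc (suc K)) v → (∀ j → PowerShaped (suc K) j v) → Alt2 (suc (suc K)) α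
alt2-of-powerShapes {α} K v avoids shaped =
  map sort v , avoids-map sort unsort v (λ {x} _ → unsort-sort x) avoids , u′ , x′ , form′ , |u′|-mono ,
  λ i j i<j → gcd-bound K (u′ i) (u′ j) (x′ i) (x′ j) (λ i≡j → <-irrefl (cong toℕ i≡j) i<j) (|u′|-mono i j i<j) (form′ i) (form′ j)
  where
  u x : Fin α → Word α
  u j = proj₁ (shaped j)
  x j = proj₁ (proj₂ (shaped j))
  form : ∀ j → v ≡ u j ++ concat (replicate (suc K) (j ∷ u j)) ++ x j
  form j = proj₂ (proj₂ (shaped j))

  ℓ : Fin α → ℕ
  ℓ j = length (u j)

  ℓ-injective : ∀ {i j} → ℓ i ≡ ℓ j → i ≡ j
  ℓ-injective {i} {j} ℓi≡ℓj = just-injective (begin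
    just i        ≡⟨ at-shape K (u i) i (x i) (form i) ⟨
    at v (ℓ i)    ≡⟨ cong (at v) ℓi≡ℓj ⟩
    at v (ℓ j)    ≡⟨ at-shape K (u j) j (x j) (form j) ⟩
    just j        ∎)
    where open ≡-Reasoning

  open Sort ℓ ℓ-injective

  unsort : Fin α → Fin α
  unsort t = proj₁ (injective⇒surjective sort-injective t)

  sort-unsort : ∀ t → sort (unsort t) ≡ t
  sort-unsort t = proj₂ (injective⇒surjective sort-injective t)

  unsort-sort : ∀ j → unsort (sort j) ≡ j
  unsort-sort j = sort-injective (sort-unsort (sort j))

  u′ x′ : Fin α → Word α
  u′ t = map sort (u (unsort t))
  x′ t = map sort (x (unsort t))

  form′ : ∀ t → map sort v ≡ u′ t ++ concat (replicate (suc K) (t ∷ u′ t)) ++ x′ t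
  form′ t = subst (λ b → map sort v ≡ u′ t ++ concat (replicate (suc K) (b ∷ u′ t)) ++ x′ t) (sort-unsort t)
    (map-shape sort (suc K) (form (unsort t)))

  |u′|-mono : ∀ i j → i Fin.< j → length (u′ i) < length (u′ j)
  |u′|-mono i j i<j = subst₂ _<_ (sym (length-map sort (u (unsort i)))) (sym (length-map sort (u (unsort j))))
    (sort-reflects-< (subst₂ Fin._<_ (sym (sort-unsort i)) (sym (sort-unsort j)) i<j))

alt2-of-tail-relabelling : ∀ {α} K {n} → Unavoidable α (suc (suc K)) n →
  ∀ c p → length (c ∷ p) ≡ n → Avoids (suc (suc K)) (c ∷ p) →
  (φ : Fin (suc α) → Fin α) (ψ : Fin α → Fin (suc α)) → (∀ {x} → x ∈ p → ψ (φ x) ≡ x) →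
  Alt2 (suc (suc K)) α
alt2-of-tail-relabelling {α} K unavoidable c p |cp|≡n avoids φ ψ inv =
  alt2-of-powerShapes K (map φ p) avoids-φp
    (λ j → powerShaped-of-image (φ[c↦ j ]) (suc K) avoids (map-φ[c↦j] j) avoids-φp
             (unavoidable (j ∷ map φ p) (trans (cong suc (length-map φ p)) |cp|≡n)))
  where
  avoids-φp : Avoids (suc (suc K)) (map φ p)
  avoids-φp = avoids-map φ ψ p inv (avoids-factor avoids (suffix-factor [ c ] p))

  c∉p : c ∉ p
  c∉p c∈p with unavoidable (map φ (c ∷ p)) (trans (length-map φ (c ∷ p)) |cp|≡n)
  ... | F , F⊑φcp , bad = avoids-map φ ψ (c ∷ p) inv′ avoids F F⊑φcp bad
    where
    inv′ : ∀ {x} → x ∈ c ∷ p → ψ (φ x) ≡ x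
    inv′ (here refl) = inv c∈p
    inv′ (there x∈p) = inv x∈p

  φ[c↦_] : Fin α → Fin (suc α) → Fin α
  φ[c↦ j ] y with y Fin.≟ c
  ... | yes _ = j
  ... | no  _ = φ y

  map-φ[c↦j] : ∀ j → map φ[c↦ j ] (c ∷ p) ≡ j ∷ map φ p
  map-φ[c↦j] j = cong₂ _∷_ c↦j (map-cong-local (All.tabulate (λ {y} y∈p → y↦φy y (λ { refl → c∉p y∈p }))))
    where
    c↦j : φ[c↦ j ] c ≡ j
    c↦j with c Fin.≟ c
    ... | yes _   = refl
    ... | no  c≢c = contradiction refl c≢c
    y↦φy : ∀ y → y ≢ c → φ[c↦ j ] y ≡ φ y
    y↦φy y y≢c with y Fin.≟ c
    ... | yes y≡c = contradiction y≡c y≢c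
    ... | no  _   = refl

alt2-of-short-tail : ∀ {α} K {n} → Unavoidable (suc α) (suc (suc K)) n →
  ∀ c p → length (c ∷ p) ≡ n → Avoids (suc (suc K)) (c ∷ p) →
  (q : Word (suc (suc α))) → (∀ {x} → x ∈ p → x ∈ q) → distinctLetters q ≢ suc (suc α) →
  Alt2 (suc (suc K)) (suc α)
alt2-of-short-tail {α} K unavoidable c p |cp|≡n avoids q p⊆q few-letters =
  alt2-of-tail-relabelling K unavoidable c p |cp|≡n avoids (encode Fin._≟_ Fin.zero d |d|≤α) (decode Fin._≟_ Fin.zero d)
    (λ x∈p → decode-encode Fin._≟_ Fin.zero d |d|≤α (∈-deduplicate⁺ Fin._≟_ (p⊆q x∈p)))
  where
  d : Word (suc (suc α))
  d = deduplicate Fin._≟_ q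
  |d|≤α : length d ≤ suc α
  |d|≤α = ≤-pred (≤∧≢⇒< (distinctLetters-≤ q) few-letters)

alt2-of-short-prefix : ∀ {α} K {n} → Unavoidable (suc α) (suc (suc K)) (suc n) →
  ∀ w → length w ≡ suc n → Avoids (suc (suc K)) w → distinctLetters (take n w) ≢ suc (suc α) →
  Alt2 (suc (suc K)) (suc α)
alt2-of-short-prefix K {n} unavoidable w |w|≡1+n avoids few-letters with reverse w in rw≡
... | [] = contradiction (trans (sym |w|≡1+n) (trans (sym (length-reverse w)) (cong length rw≡))) λ ()
... | c ∷ r = alt2-of-short-tail K unavoidable c r |cr|≡1+n (subst (Avoids _) rw≡ (avoids-reverse w avoids))
                (take n w) (λ x∈r → subst (_ ∈_) (sym take≡reverse-r) (Any.reverse⁺ x∈r)) few-letters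
  where
  |cr|≡1+n : length (c ∷ r) ≡ suc n
  |cr|≡1+n = trans (cong length (sym rw≡)) (trans (length-reverse w) |w|≡1+n)
  take≡reverse-r : take n w ≡ reverse r
  take≡reverse-r = begin
    take n w                                        ≡⟨ cong (take n) (trans (sym (reverse-involutive w)) (cong reverse rw≡)) ⟩
    take n (reverse (c ∷ r))                        ≡⟨ cong (take n) (unfold-reverse c r) ⟩
    take n (reverse r ++ [ c ])                     ≡⟨ cong (λ i → take i (reverse r ++ [ c ])) n≡|reverse-r| ⟩
    take (length (reverse r)) (reverse r ++ [ c ])  ≡⟨ take-length-++ (reverse r) [ c ] ⟩
    reverse r                                       ∎
    where
    open ≡-Reasoning
    n≡|reverse-r| : n ≡ length (reverse r)
    n≡|reverse-r| = trans (suc-injective (sym |cr|≡1+n)) (sym (length-reverse r))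

alt1⊎counterexample : ∀ K α N → Alt1 (suc K) α N ⊎
  ∃[ w ] (length w ≡ N × Avoids (suc K) w ×
          (distinctLetters (take (N ∸ 1) w) ≢ suc α ⊎ distinctLetters (drop 1 w) ≢ suc α))
alt1⊎counterexample K α N = ∀⊎∃-Word decide N
  where
  ManyLetters ShortEnd : Word (suc α) → Set
  ManyLetters w = distinctLetters (take (N ∸ 1) w) ≡ suc α × distinctLetters (drop 1 w) ≡ suc α
  ShortEnd    w = distinctLetters (take (N ∸ 1) w) ≢ suc α ⊎ distinctLetters (drop 1 w) ≢ suc α
  decide : ∀ w → (Avoids (suc K) w → ManyLetters w) ⊎ (Avoids (suc K) w × ShortEnd w)
  decide w with avoids? Fin._≟_ K w | distinctLetters (take (N ∸ 1) w) ≟ℕ suc α | distinctLetters (drop 1 w) ≟ℕ suc α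
  ... | no ¬avoids | _        | _        = inj₁ (λ avoids → contradiction avoids ¬avoids)
  ... | yes _      | yes eq₁  | yes eq₂  = inj₁ (λ _ → eq₁ , eq₂)
  ... | yes avoids | no  neq₁ | _        = inj₂ (avoids , inj₁ neq₁)
  ... | yes avoids | yes _    | no  neq₂ = inj₂ (avoids , inj₂ neq₂)

lemma5p2 : (k : ℕ) → 1 < k → (α : ℕ) → 2 ≤ α → (n m : ℕ) →
    IsN α k n → IsN (suc α) k m → n < m → Alt1 k α n ⊎ Alt2 k α
lemma5p2 (suc zero) (s≤s ()) _ _ _ _ _ _ _
lemma5p2 _ _ _ _ zero _ (() , _) _ _
lemma5p2 (suc (suc K)) _ (suc α) _ (suc n) _ (_ , unavoidable , _) _ _
  with alt1⊎counterexample (suc K) (suc α) (suc n)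
... | inj₁ alt1 = inj₁ alt1
... | inj₂ (c ∷ p , |w|≡n , avoids , inj₂ few-in-suffix) =
  inj₂ (alt2-of-short-tail K unavoidable c p |w|≡n avoids p (λ x∈p → x∈p) few-in-suffix)
... | inj₂ (w , |w|≡n , avoids , inj₁ few-in-prefix) =
  inj₂ (alt2-of-short-prefix K unavoidable w |w|≡n avoids few-in-prefix)
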